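{- If $G$ is a traceable graph (i.e., $G$ contains a path through all of its vertices) of order $n\geq 3$, then $px_k(G)=2$ for each integer $k$ with $3\leq k\leq n$.
   Context: All graphs are finite, simple, undirected and connected. An edge-coloring of a graph $G$ assigns colors to edges (adjacent edges may receive the same color). A tree in an edge-colored graph is a proper tree if any two adjacent edges of it receive different colors. For $S\subseteq V(G)$, an $S$-tree is a tree in $G$ containing all vertices of $S$. For a graph $G$ of order $n$ and an integer $k$ with $2\leq k\leq n$, an edge-coloring of $G$ is a $k$-proper coloring if for every set $S$ of $k$ vertices of $G$ there is a proper $S$-tree in $G$. The $k$-proper index $px_k(G)$ of a nontrivial connected graph $G$ is the smallest number of colors in a $k$-proper coloring of $G$. -}

module Defs where

open import Data.Nat using (ℕ; _≤_; _≥_)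
open import Data.Fin using (Fin)
open import Data.Fin.Subset using (Subset; _∈_; _⊆_; ∣_∣)
open import Data.List using (List; []; _∷_; _++_; [_]; length)
open import Data.List.Relation.Unary.Linked using (Linked)
open import Data.List.Relation.Unary.Unique.Propositional using (Unique)
import Data.List.Membership.Propositional as LMem
open import Data.Product using (Σ; ∃; _×_)
open import Relation.Binary.Construct.Closure.ReflexiveTransitive using (Star)
open import Relation.Binary.PropositionalEquality using (_≡_; _≢_)
open import Relation.Nullary using (¬_)

record Graph (n : ℕ) : Set₁ where
  field
    Adj     : Fin n → Fin n → Set
    symAdj  : ∀ {u v} → Adj u v → Adj v u
    irrefl  : ∀ {u} → ¬ Adj u u

open Graph public

Connected : ∀ {n} → Graph n → Set
Connected {n} G = ∀ (u v : Fin n) → Star (Adj G) u v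

Traceable : ∀ {n} → Graph n → Set
Traceable {n} G =
  Σ (List (Fin n)) λ xs →
    Unique xs × Linked (Adj G) xs × (∀ (v : Fin n) → v LMem.∈ xs)

-- An edge-coloring with (at most) m colors; only values on edges matter.
record EdgeColoring {n} (G : Graph n) (m : ℕ) : Set where
  field
    col    : Fin n → Fin n → Fin m
    colSym : ∀ u v → col u v ≡ col v u

open EdgeColoring public

record Subgraph {n} (G : Graph n) : Set₁ where
  field
    V       : Subset n
    E       : Fin n → Fin n → Set
    E⊆Adj   : ∀ {u v} → E u v → Adj G u v
    symE    : ∀ {u v} → E u v → E v u
    E⊆V     : ∀ {u v} → E u v → u ∈ V

open Subgraph public

HasCycle : ∀ {n} → (Fin n → Fin n → Set) → Set
HasCycle {n} E =
  Σ (Fin n) λ x → Σ (List (Fin n)) λ ys →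
    (length (x ∷ ys) ≥ 3) × Unique (x ∷ ys) × Linked E (x ∷ ys ++ [ x ])

IsTree : ∀ {n} {G : Graph n} → Subgraph G → Set
IsTree {n} T =
  (∀ (u v : Fin n) → u ∈ V T → v ∈ V T → Star (E T) u v) × ¬ HasCycle (E T)

ProperUnder : ∀ {n m} {G : Graph n} → EdgeColoring G m → Subgraph G → Set
ProperUnder {n} c T =
  ∀ (u v w : Fin n) → E T u v → E T v w → u ≢ w → col c u v ≢ col c v w

KProper : ∀ {n m} {G : Graph n} → ℕ → EdgeColoring G m → Set₁
KProper {n} {m} {G} k c =
  ∀ (S : Subset n) → ∣ S ∣ ≡ k →
    Σ (Subgraph G) λ T → IsTree T × S ⊆ V T × ProperUnder c T

PxEq : ∀ {n} → Graph n → ℕ → ℕ → Set₁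
PxEq G k p =
  (Σ (EdgeColoring G p) λ c → KProper k c) ×
  (∀ (m : ℕ) (c : EdgeColoring G m) → KProper k c → p ≤ m)

module Submission where

-- Upper bound: the Hamiltonian path itself is a spanning tree, and colouring its edges
-- alternately makes it proper, so this one tree serves every vertex set.  Lower bound:
-- under a single colour a proper tree has no two adjacent edges, so every walk in it
-- just bounces along one edge; such a tree cannot contain three distinct vertices.

open import Defs
open import Data.Nat using (ℕ; zero; suc; _≤_; _<_; _⊓_; s≤s; z≤n)
open import Data.Nat.Properties using (suc-injective; ≤-reflexive; <-irrefl; <-trans; n≤1+n; m≤n⇒m⊓n≡m; ⊓-comm)
open import Data.Product using (∃; _×_; _,_; proj₁; proj₂)
import Data.Product as Product
open import Data.Sum using (_⊎_; inj₁; inj₂; swap)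
open import Data.Unit using (⊤; tt)
open import Data.Empty using (⊥-elim)
open import Data.Fin using (Fin; zero; suc; _≟_)
open import Data.Fin.Properties using (¬Fin0)
open import Data.Fin.Subset using (Subset; inside; ∣_∣)
import Data.Fin.Subset as Subset
open import Data.Fin.Subset.Properties using (∈⊤; ∣⊥∣≡0)
import Data.Vec.Base as Vec
open import Data.List using (List; []; _∷_; _++_; [_])
open import Data.List.Relation.Unary.Any using (here; there)
import Data.List.Relation.Unary.All as All
open import Data.List.Relation.Unary.All using ([]; _∷_)
import Data.List.Relation.Unary.AllPairs as AllPairs
open import Data.List.Relation.Unary.AllPairs using ([]; _∷_)
open import Data.List.Relation.Unary.Linked using (Linked; [-]; _∷_)
import Data.List.Relation.Unary.Linked as Linked
open import Data.List.Relation.Unary.Linked.Properties using (Linked⇒AllPairs)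
open import Data.List.Relation.Unary.Unique.Propositional using (Unique)
import Data.List.Relation.Unary.Unique.Propositional.Properties as Unique
open import Data.List.Membership.Propositional using (_∈_)
open import Data.List.Membership.Propositional.Properties using (∈-++⁺ʳ)
open import Relation.Binary.Definitions using (Transitive)
open import Relation.Binary.Construct.Closure.ReflexiveTransitive using (Star; ε; _◅_; _◅◅_; reverse)
open import Relation.Binary.PropositionalEquality using (_≡_; _≢_; refl; sym; trans; cong; subst; module ≡-Reasoning)
open import Relation.Nullary using (¬_; contradiction)
open import Relation.Nullary.Decidable using (decidable-stable)

infix 4 _[_]=_

data _[_]=_ {A : Set} : List A → ℕ → A → Set where
  here  : ∀ {x xs} → (x ∷ xs) [ 0 ]= x
  there : ∀ {x y xs i} → xs [ i ]= y → (x ∷ xs) [ suc i ]= y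

module _ {A : Set} where

  ∈⇒[]= : ∀ {x : A} {xs} → x ∈ xs → ∃ λ i → xs [ i ]= x
  ∈⇒[]= (here refl)  = 0 , here
  ∈⇒[]= (there x∈xs) = Product.map suc there (∈⇒[]= x∈xs)

  []=⇒∈ : ∀ {x : A} {xs i} → xs [ i ]= x → x ∈ xs
  []=⇒∈ here      = here refl
  []=⇒∈ (there p) = there ([]=⇒∈ p)

  []=-functional : ∀ {x y : A} {xs i} → xs [ i ]= x → xs [ i ]= y → x ≡ y
  []=-functional here      here      = refl
  []=-functional (there p) (there q) = []=-functional p q

  []=-injective : ∀ {x : A} {xs i j} → Unique xs → xs [ i ]= x → xs [ j ]= x → i ≡ j
  []=-injective _             here      here      = refl
  []=-injective (x≢xs ∷ _)    here      (there q) = ⊥-elim (All.lookup x≢xs ([]=⇒∈ q) refl)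
  []=-injective (x≢xs ∷ _)    (there p) here      = ⊥-elim (All.lookup x≢xs ([]=⇒∈ p) refl)
  []=-injective (_ ∷ unique)  (there p) (there q) = cong suc ([]=-injective unique p q)

  []=-head : ∀ {y : A} {xs i} → xs [ i ]= y → ∃ λ x → xs [ 0 ]= x
  []=-head here      = _ , here
  []=-head (there _) = _ , here

  []=-pred : ∀ {y : A} {xs i} → xs [ suc i ]= y → ∃ λ x → xs [ i ]= x
  []=-pred (there here)      = _ , here
  []=-pred (there (there p)) = Product.map₂ there ([]=-pred (there p))

  Linked-[]= : ∀ {R : A → A → Set} {x y xs i} → Linked R xs → xs [ i ]= x → xs [ suc i ]= y → R x y
  Linked-[]= (r ∷ _)  here      (there here) = r
  Linked-[]= (_ ∷ rs) (there p) (there q)    = Linked-[]= rs p q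
  Linked-[]= [-]      _         (there ())

  NonBacktracking : List A → Set
  NonBacktracking (a ∷ b ∷ c ∷ l) = a ≢ c × NonBacktracking (b ∷ c ∷ l)
  NonBacktracking _               = ⊤

  Unique⇒NonBacktracking : ∀ {xs} → Unique xs → NonBacktracking xs
  Unique⇒NonBacktracking {[]}              _                      = tt
  Unique⇒NonBacktracking {_ ∷ []}          _                      = tt
  Unique⇒NonBacktracking {_ ∷ _ ∷ []}      _                      = tt
  Unique⇒NonBacktracking {_ ∷ _ ∷ _ ∷ _} ((_ ∷ a≢c ∷ _) ∷ unique) = a≢c , Unique⇒NonBacktracking unique

  Unique-rotate : ∀ {x : A} {xs} → Unique (x ∷ xs) → Unique (xs ++ [ x ])
  Unique-rotate (x≢xs ∷ unique) =
    Unique.++⁺ unique ([] ∷ []) λ { (x∈xs , here refl) → All.lookup x≢xs x∈xs refl }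

  cycle-nonBacktracking : ∀ {x y z : A} {r} → Unique (x ∷ y ∷ z ∷ r) → NonBacktracking (x ∷ y ∷ z ∷ r ++ [ x ])
  cycle-nonBacktracking unique@((_ ∷ x≢z ∷ _) ∷ _) = x≢z , Unique⇒NonBacktracking (Unique-rotate unique)

  -- A left-unique R cannot be followed backwards right after a forward step without backtracking.
  forward : ∀ {R : A → A → Set} → (∀ {u v w} → R u w → R v w → u ≡ v) →
            ∀ {a b l} → Linked (λ u v → R u v ⊎ R v u) (a ∷ b ∷ l) → NonBacktracking (a ∷ b ∷ l) →
            R a b → Linked R (a ∷ b ∷ l)
  forward _          (_ ∷ [-])                 _         ab = ab ∷ [-]
  forward leftUnique (_ ∷ walk@(inj₁ bc ∷ _)) (_ , nb)  ab = ab ∷ forward leftUnique walk nb bc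
  forward leftUnique (_ ∷ (inj₂ cb ∷ _))      (a≢c , _) ab = contradiction (leftUnique ab cb) a≢c

  Linked⇒head-last : ∀ {R : A → A → Set} → Transitive R → ∀ {x y} ys → Linked R (x ∷ ys ++ [ y ]) → R x y
  Linked⇒head-last trans ys chain =
    All.lookup (AllPairs.head (Linked⇒AllPairs trans chain)) (∈-++⁺ʳ ys (here refl))

parity : ℕ → Fin 2
parity zero          = zero
parity (suc zero)    = suc zero
parity (suc (suc n)) = parity n

parity-suc : ∀ n → parity (suc n) ≢ parity n
parity-suc zero          ()
parity-suc (suc zero)    ()
parity-suc (suc (suc n)) = parity-suc n

module Ranking {A : Set} (pos : A → ℕ) (pos-injective : ∀ {u v} → pos u ≡ pos v → u ≡ v) where

  Next : A → A → Set
  Next u v = pos v ≡ suc (pos u)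

  Edge : A → A → Set
  Edge u v = Next u v ⊎ Next v u

  Next⇒< : ∀ {u v} → Next u v → pos u < pos v
  Next⇒< uv = ≤-reflexive (sym uv)

  Next-leftUnique : ∀ {u v w} → Next u w → Next v w → u ≡ v
  Next-leftUnique uw vw = pos-injective (suc-injective (trans (sym uw) vw))

  Next-rightUnique : ∀ {u v w} → Next u v → Next u w → v ≡ w
  Next-rightUnique uv uw = pos-injective (trans uv (sym uw))

  -- A cycle is non-backtracking, hence rank-monotone along its whole length, yet returns to its start.
  no-cycle : ∀ {x y z r} → Unique (x ∷ y ∷ z ∷ r) → ¬ Linked Edge (x ∷ y ∷ z ∷ r ++ [ x ])
  no-cycle {y = y} {z} {r} unique walk@(inj₁ xy ∷ _) =
    <-irrefl refl (Linked⇒head-last <-trans (y ∷ z ∷ r)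
      (Linked.map Next⇒< (forward Next-leftUnique walk (cycle-nonBacktracking unique) xy)))
  no-cycle {y = y} {z} {r} unique walk@(inj₂ yx ∷ _) =
    <-irrefl refl (Linked⇒head-last (λ p q → <-trans q p) (y ∷ z ∷ r)
      (Linked.map Next⇒< (forward {R = λ u v → Next v u} Next-rightUnique (Linked.map swap walk)
        (cycle-nonBacktracking unique) yx)))

  Edge-connected : (∀ {v i} → pos v ≡ suc i → ∃ λ u → Next u v) → ∀ {r} → pos r ≡ 0 → ∀ u v → Star Edge u v
  Edge-connected predecessor {r} r-first u v = toFirst (pos u) u refl ◅◅ reverse swap (toFirst (pos v) v refl)
    where
    toFirst : ∀ i v → pos v ≡ i → Star Edge v r
    toFirst zero    v v-first = subst (Star Edge v) (pos-injective (trans v-first (sym r-first))) ε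
    toFirst (suc i) v v-at    =
      let u , uv = predecessor v-at in inj₂ uv ◅ toFirst i u (suc-injective (trans (sym uv) v-at))

  colour : A → A → Fin 2
  colour u v = parity (pos u ⊓ pos v)

  colour-sym : ∀ u v → colour u v ≡ colour v u
  colour-sym u v = cong parity (⊓-comm (pos u) (pos v))

  colour-Next : ∀ {u v} → Next u v → colour u v ≡ parity (pos u)
  colour-Next {u} uv = cong parity (trans (cong (pos u ⊓_) uv) (m≤n⇒m⊓n≡m (n≤1+n (pos u))))

  Next-colours-differ : ∀ {u v w} → Next u v → Next v w → colour u v ≢ colour v w
  Next-colours-differ {u} {v} {w} uv vw same = parity-suc (pos u) (sym (begin
    parity (pos u)       ≡⟨ colour-Next uv ⟨
    colour u v           ≡⟨ same ⟩
    colour v w           ≡⟨ colour-Next vw ⟩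
    parity (pos v)       ≡⟨ cong parity uv ⟩
    parity (suc (pos u)) ∎))
    where open ≡-Reasoning

  Edge-colours-differ : ∀ {u v w} → Edge u v → Edge v w → u ≢ w → colour u v ≢ colour v w
  Edge-colours-differ             (inj₁ uv) (inj₁ vw) _   = Next-colours-differ uv vw
  Edge-colours-differ {u} {v} {w} (inj₂ vu) (inj₂ wv) _   = λ same →
    Next-colours-differ wv vu (trans (colour-sym w v) (trans (sym same) (colour-sym u v)))
  Edge-colours-differ             (inj₁ uv) (inj₂ wv) u≢w = λ _ → u≢w (Next-leftUnique uv wv)
  Edge-colours-differ             (inj₂ vu) (inj₁ vw) u≢w = λ _ → u≢w (Next-rightUnique vu vw)

module HamiltonianPath {n : ℕ} (G : Graph n) (xs : List (Fin n)) (unique : Unique xs)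
                       (linked : Linked (Adj G) xs) (complete : ∀ v → v ∈ xs) where

  pos : Fin n → ℕ
  pos v = proj₁ (∈⇒[]= (complete v))

  pos-correct : ∀ v → xs [ pos v ]= v
  pos-correct v = proj₂ (∈⇒[]= (complete v))

  pos-unique : ∀ {v i} → xs [ i ]= v → pos v ≡ i
  pos-unique = []=-injective unique (pos-correct _)

  pos-injective : ∀ {u v} → pos u ≡ pos v → u ≡ v
  pos-injective {u} {v} eq = []=-functional (pos-correct u) (subst (xs [_]= v) (sym eq) (pos-correct v))

  open Ranking pos pos-injective

  Next⇒Adj : ∀ {u v} → Next u v → Adj G u v
  Next⇒Adj {u} {v} uv = Linked-[]= linked (pos-correct u) (subst (xs [_]= v) uv (pos-correct v))

  predecessor : ∀ {v i} → pos v ≡ suc i → ∃ λ u → Next u v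
  predecessor {v} v-at =
    let u , u-at = []=-pred (subst (xs [_]= v) v-at (pos-correct v))
    in u , trans v-at (cong suc (sym (pos-unique u-at)))

  pathTree : Subgraph G
  pathTree = record
    { V     = Subset.⊤
    ; E     = Edge
    ; E⊆Adj = λ { (inj₁ uv) → Next⇒Adj uv ; (inj₂ vu) → symAdj G (Next⇒Adj vu) }
    ; symE  = swap
    ; E⊆V   = λ _ → ∈⊤
    }

  pathTree-connected : ∀ u v → Star Edge u v
  pathTree-connected u = Edge-connected predecessor (pos-unique (proj₂ ([]=-head (pos-correct u)))) u

  pathTree-acyclic : ¬ HasCycle Edge
  pathTree-acyclic (_ , []        , s≤s ()       , _)
  pathTree-acyclic (_ , _ ∷ []    , s≤s (s≤s ()) , _)
  pathTree-acyclic (_ , _ ∷ _ ∷ _ , _            , unique , walk) = no-cycle unique walk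

  pathColouring : EdgeColoring G 2
  pathColouring = record { col = colour ; colSym = colour-sym }

  pathColouring-kProper : ∀ k → KProper k pathColouring
  pathColouring-kProper _ _ _ =
    pathTree , ((λ u v _ _ → pathTree-connected u v) , pathTree-acyclic) , (λ _ → ∈⊤) ,
    λ _ _ _ → Edge-colours-differ

module _ {A : Set} {E : A → A → Set} (backtracking : ∀ {u v w} → E u v → E v w → u ≡ w) where

  walk-ends : ∀ {a q b} → E a q → Star E q b → b ≡ q ⊎ b ≡ a
  walk-ends _  ε = inj₁ refl
  walk-ends aq (qy ◅ rest) with backtracking aq qy
  ... | refl = swap (walk-ends qy rest)

  Star⇒edge : ∀ {a b} → Star E a b → a ≢ b → E a b
  Star⇒edge ε            a≢a = contradiction refl a≢a
  Star⇒edge (aq ◅ rest) a≢b with walk-ends aq rest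
  ... | inj₁ refl = aq
  ... | inj₂ refl = contradiction refl a≢b

  reachable-others-coincide : (∀ {u v} → E u v → E v u) →
                              ∀ {a b c} → Star E a b → Star E a c → a ≢ b → a ≢ c → b ≡ c
  reachable-others-coincide E-sym ab ac a≢b a≢c = backtracking (E-sym (Star⇒edge ab a≢b)) (Star⇒edge ac a≢c)

Fin1-≡ : (i j : Fin 1) → i ≡ j
Fin1-≡ zero zero = refl

proper-one-colour⇒backtracking : ∀ {n} {G : Graph n} (c : EdgeColoring G 1) (T : Subgraph G) → ProperUnder c T →
                                 ∀ {u v w} → E T u v → E T v w → u ≡ w
proper-one-colour⇒backtracking c T proper {u} {v} {w} uv vw =
  decidable-stable (u ≟ w) λ u≢w → proper u v w uv vw u≢w (Fin1-≡ _ _)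

initialSegment : ∀ {n} k → k ≤ n → Subset n
initialSegment zero    _         = Subset.⊥
initialSegment (suc k) (s≤s k≤n) = inside Vec.∷ initialSegment k k≤n

∣initialSegment∣ : ∀ {n} k (k≤n : k ≤ n) → ∣ initialSegment k k≤n ∣ ≡ k
∣initialSegment∣ {n} zero    _         = ∣⊥∣≡0 n
∣initialSegment∣     (suc k) (s≤s k≤n) = cong suc (∣initialSegment∣ k k≤n)

one-colour-not-kProper : ∀ {n k} {G : Graph n} → 3 ≤ k → k ≤ n → (c : EdgeColoring G 1) → ¬ KProper k c
one-colour-not-kProper {k = k} (s≤s (s≤s (s≤s _))) k≤n@(s≤s (s≤s (s≤s _))) c kProper
  with kProper (initialSegment k k≤n) (∣initialSegment∣ k k≤n)
... | T , (T-connected , _) , S⊆T , proper = contradiction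
  (reachable-others-coincide (proper-one-colour⇒backtracking c T proper) (symE T)
     (reachable-from-0 (Vec.there Vec.here)) (reachable-from-0 (Vec.there (Vec.there Vec.here))) (λ ()) (λ ()))
  (λ ())
  where
  reachable-from-0 : ∀ {v} → v Subset.∈ initialSegment k k≤n → Star (E T) zero v
  reachable-from-0 v∈S = T-connected zero _ (S⊆T Vec.here) (S⊆T v∈S)

kProper⇒2≤colours : ∀ {n k m} {G : Graph n} → 3 ≤ k → k ≤ n → (c : EdgeColoring G m) → KProper k c → 2 ≤ m
kProper⇒2≤colours {m = zero}        (s≤s _) (s≤s _) c _   = ⊥-elim (¬Fin0 (col c zero zero))
kProper⇒2≤colours {m = suc zero}    3≤k     k≤n     c kp  = ⊥-elim (one-colour-not-kProper 3≤k k≤n c kp)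
kProper⇒2≤colours {m = suc (suc _)} _       _       _ _   = s≤s (s≤s z≤n)

proposition2p5 : ∀ (n : ℕ) (G : Graph n) → Connected G → Traceable G → 3 ≤ n →
                   ∀ (k : ℕ) → 3 ≤ k × k ≤ n → PxEq G k 2
proposition2p5 n G _ (xs , unique , linked , complete) _ k (3≤k , k≤n) =
  (pathColouring , pathColouring-kProper k) , λ _ c → kProper⇒2≤colours 3≤k k≤n c
  where open HamiltonianPath G xs unique linked complete
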